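{- Let $r\ge 2$ be a fixed integer and let $m=m(n)$ satisfy $n\ge m$ and $m/\log n\to\infty$ as $n\to\infty$. Then \[ \kappa_{r,2}(m,n) \sim \left(1-\frac{1}{r}\right)m \qquad (n\to\infty). \]
   Context: $K_{m,n}$ denotes the complete bipartite graph with vertex classes $[m]$ and $[n]$. An $r$-edge-coloring is a map $c:E(K_{m,n})\to[r]$ (not all colors need be used). A path is alternating if any two adjacent (consecutive) edges of it have different colors; the length of a path is its number of edges. Paths between two vertices are internally disjoint if they share no vertices other than their endpoints. $\kappa_{r,2k}(m,n)$ is the maximum $t$ such that there is an $r$-edge-coloring of $K_{m,n}$ in which every pair of distinct vertices of the class $[n]$ is connected by $t$ internally disjoint alternating paths of length $2k$. $f\sim g$ means $f/g\to1$ as $n\to\infty$; $\log$ is the natural logarithm. -}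

module Defs where

open import Data.Nat using (ℕ; suc; _+_; _*_; _∸_; _^_; _≤_; ∣_-_∣)
open import Data.Fin using (Fin)
open import Data.Product using (Σ; _×_; ∃; ∃-syntax)
open import Function.Definitions using (Injective)
open import Relation.Binary.PropositionalEquality using (_≡_; _≢_)

-- K_{m,n}: vertex classes [m] = Fin m and [n] = Fin n; every a ∈ [m] is
-- adjacent to every b ∈ [n].  An r-edge-coloring assigns to the edge {a,b}
-- the colour  c a b ∈ [r] = Fin r  (not all colours need be used).
Coloring : ℕ → ℕ → ℕ → Set
Coloring r m n = Fin m → Fin n → Fin r

-- A path of length 2 in K_{m,n} between distinct vertices u, v of the class
-- [n] is necessarily u – w – v for a middle vertex w ∈ [m]; it is
-- determined by w.
Alternating2 : ∀ {r m n} → Coloring r m n → Fin n → Fin n → Fin m → Set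
Alternating2 c u v w = c w u ≢ c w v

-- t internally disjoint alternating paths of length 2 between u and v:
-- t such paths (given by their middle vertices) sharing no vertex other
-- than u and v, i.e. with pairwise distinct middle vertices.
DisjointAltPaths2 : ∀ {r m n} → Coloring r m n → Fin n → Fin n → ℕ → Set
DisjointAltPaths2 {m = m} c u v t =
  Σ (Fin t → Fin m) λ mid →
    Injective _≡_ _≡_ mid × (∀ i → Alternating2 c u v (mid i))

Attainable2 : ℕ → ℕ → ℕ → ℕ → Set
Attainable2 r m n t =
  Σ (Coloring r m n) λ c → ∀ (u v : Fin n) → u ≢ v → DisjointAltPaths2 c u v t

IsKappa2 : ℕ → ℕ → ℕ → ℕ → Set
IsKappa2 r m n k = Attainable2 r m n k × (∀ t → Attainable2 r m n t → t ≤ k)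

-- m(n)/log n → ∞, stated without reals: for every C, eventually
-- C·log₂ n ≤ m(n), i.e. n^C ≤ 2^{m(n)}.  (log₂ vs ln only changes a
-- constant factor, irrelevant for divergence to ∞.)
DivergesOverLog : (ℕ → ℕ) → Set
DivergesOverLog m = ∀ (C : ℕ) → ∃[ N ] ∀ n → N ≤ n → n ^ C ≤ 2 ^ m n

-- f(n) ~ (1 - 1/r)·m(n), i.e. f/((r-1)m/r) → 1: for every ε = 1/(j+1),
-- eventually |r·f(n) − (r−1)·m(n)| ≤ ε·(r−1)·m(n).
AsympKappa : ℕ → (ℕ → ℕ) → (ℕ → ℕ) → Set
AsympKappa r m f =
  ∀ (j : ℕ) → ∃[ N ] ∀ n → N ≤ n →
    ∣ r * f n - (r ∸ 1) * m n ∣ * suc j ≤ (r ∸ 1) * m n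

-- Upper bound: a middle vertex w splits [n] into r colour classes, so by
-- Cauchy–Schwarz at least n²/r ordered pairs (u, v) see the same colour at w,
-- and w is then not an alternating middle for them.  Summing over w, the n(n−1)
-- ordered pairs of distinct vertices have on average at most
-- (1 − 1/r)·m·n/(n − 1) alternating middles.
--
-- Lower bound: a concatenated code.  Greedily (Gilbert–Varshamov) choose n words
-- of length M over an alphabet of size Q with pairwise agreement below
-- a ≈ M/E; this is possible because m ≫ log n.  Replace every letter x by the
-- word (f x) indexed by all f : [Q] → [r], in which distinct letters agree in
-- exactly a 1/r fraction of the positions.  Reading the positions as middle
-- vertices gives a colouring in which any two vertices agree in at most about
-- (1/r + 1/E)·m middles, and every other middle is an alternating path.

module Submission where

open import Defs
import Algebra.Properties.Semiring.Sum as Sum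
open import Data.Fin using (Fin; zero; suc; punchIn; punchOut; splitAt; _↑ˡ_; _↑ʳ_; remQuot; finToFun)
open import Data.Fin.Properties using (_≟_; any?; splitAt-↑ˡ; splitAt-↑ʳ; suc-injective; punchIn-injective; punchInᵢ≢i; punchOut-injective; punchIn-punchOut)
open import Data.Nat using (ℕ; zero; suc; _+_; _*_; _∸_; _^_; _≤_; _<_; z≤n; s≤s; s≤s⁻¹; NonZero; >-nonZero; ∣_-_∣)
open import Data.Nat.DivMod using (_/_; _%_; m≡m%n+[m/n]*n; m%n<n; m*n/n≡m; m/n*n≤m; /-monoˡ-≤; n/n≡1)
open import Data.Nat.Properties hiding (_≟_; suc-injective)
open import Data.Nat.Tactic.RingSolver using (solve-∀)
open import Data.Product using (Σ; _×_; _,_; proj₁; proj₂; ∃-syntax; uncurry; map₁)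
open import Data.Sum using (_⊎_; inj₁; inj₂; [_,_]′)
open import Function using (_∘_)
open import Function.Definitions using (Injective)
open import Relation.Binary.PropositionalEquality
open import Relation.Unary using (Decidable)
open import Relation.Nullary using (¬_; Dec; yes; no; ¬?; contradiction)

open Sum +-*-semiring using (sum-syntax; sum-cong-≗; ∑-distrib-+; ∑-comm; *-distribˡ-sum; *-distribʳ-sum)

∑-const : ∀ n k → ∑[ i < n ] k ≡ n * k
∑-const zero    k = refl
∑-const (suc n) k = cong (k +_) (∑-const n k)

∑1≡n : ∀ n → ∑[ i < n ] 1 ≡ n
∑1≡n n = trans (∑-const n 1) (*-identityʳ n)

∑-mono-≤ : ∀ {n} {f g : Fin n → ℕ} → (∀ i → f i ≤ g i) → ∑[ i < n ] f i ≤ ∑[ i < n ] g i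
∑-mono-≤ {zero}  _   = z≤n
∑-mono-≤ {suc n} f≤g = +-mono-≤ (f≤g zero) (∑-mono-≤ (f≤g ∘ suc))

∑≡0⇒≡0 : ∀ {n} (f : Fin n → ℕ) → ∑[ i < n ] f i ≡ 0 → ∀ i → f i ≡ 0
∑≡0⇒≡0 f ∑≡0 zero    = m+n≡0⇒m≡0 (f zero) ∑≡0
∑≡0⇒≡0 f ∑≡0 (suc i) = ∑≡0⇒≡0 (f ∘ suc) (m+n≡0⇒n≡0 (f zero) ∑≡0) i

∑<n⇒∃≡0 : ∀ {n} (f : Fin n → ℕ) → ∑[ i < n ] f i < n → ∃[ i ] f i ≡ 0
∑<n⇒∃≡0 {suc n} f ∑<n with f zero in f₀≡
... | zero  = zero , f₀≡
... | suc k with i , fi≡0 ← ∑<n⇒∃≡0 (f ∘ suc) (≤-trans (s≤s (m≤n+m _ k)) (s≤s⁻¹ ∑<n)) = suc i , fi≡0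

∑-↑ : ∀ a b (f : Fin (a + b) → ℕ) →
      ∑[ i < a + b ] f i ≡ ∑[ i < a ] f (i ↑ˡ b) + ∑[ i < b ] f (a ↑ʳ i)
∑-↑ zero    b f = refl
∑-↑ (suc a) b f = trans (cong (f zero +_) (∑-↑ a b (f ∘ suc))) (sym (+-assoc (f zero) _ _))

∑-splitAt : ∀ a b (h : Fin a ⊎ Fin b → ℕ) →
            ∑[ i < a + b ] h (splitAt a i) ≡ ∑[ i < a ] h (inj₁ i) + ∑[ i < b ] h (inj₂ i)
∑-splitAt a b h = trans (∑-↑ a b (h ∘ splitAt a))
  (cong₂ _+_ (sum-cong-≗ (λ i → cong h (splitAt-↑ˡ a i b))) (sum-cong-≗ (λ i → cong h (splitAt-↑ʳ a b i))))

∑-remQuot : ∀ a b (h : Fin a → Fin b → ℕ) →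
            ∑[ i < a * b ] uncurry h (remQuot b i) ≡ ∑[ x < a ] ∑[ y < b ] h x y
∑-remQuot zero    b h = refl
∑-remQuot (suc a) b h = begin
  ∑[ i < b + a * b ] uncurry h (remQuot b i)
    ≡⟨ ∑-↑ b (a * b) _ ⟩
  ∑[ y < b ] uncurry h (remQuot b (y ↑ˡ a * b)) + ∑[ i < a * b ] uncurry h (remQuot b (b ↑ʳ i))
    ≡⟨ cong₂ _+_ (sum-cong-≗ (cong (uncurry h) ∘ remQuot-↑ˡ)) (sum-cong-≗ (cong (uncurry h) ∘ remQuot-↑ʳ)) ⟩
  ∑[ y < b ] h zero y + ∑[ i < a * b ] uncurry (h ∘ suc) (remQuot b i)
    ≡⟨ cong (∑[ y < b ] h zero y +_) (∑-remQuot a b (h ∘ suc)) ⟩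
  ∑[ y < b ] h zero y + ∑[ x < a ] ∑[ y < b ] h (suc x) y
    ∎
  where
  open ≡-Reasoning
  remQuot-↑ˡ : ∀ y → remQuot {suc a} b (y ↑ˡ a * b) ≡ (zero , y)
  remQuot-↑ˡ y rewrite splitAt-↑ˡ b y (a * b) = refl
  remQuot-↑ʳ : ∀ i → remQuot {suc a} b (b ↑ʳ i) ≡ map₁ suc (remQuot {a} b i)
  remQuot-↑ʳ i rewrite splitAt-↑ʳ b (a * b) i = refl

𝟙 : ∀ {p} {P : Set p} → Dec P → ℕ
𝟙 (yes _) = 1
𝟙 (no _)  = 0

𝟙≤1 : ∀ {p} {P : Set p} (P? : Dec P) → 𝟙 P? ≤ 1
𝟙≤1 (yes _) = s≤s z≤n
𝟙≤1 (no _)  = z≤n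

𝟙-yes : ∀ {p} {P : Set p} (P? : Dec P) → P → 𝟙 P? ≡ 1
𝟙-yes (yes _) _  = refl
𝟙-yes (no ¬p) p = contradiction p ¬p

𝟙≡0⇒¬ : ∀ {p} {P : Set p} (P? : Dec P) → 𝟙 P? ≡ 0 → ¬ P
𝟙≡0⇒¬ (no ¬p) _ = ¬p

𝟙-mono : ∀ {p q} {P : Set p} {Q : Set q} (P? : Dec P) (Q? : Dec Q) → (P → Q) → 𝟙 P? ≤ 𝟙 Q?
𝟙-mono (yes p) (yes _) _   = ≤-refl
𝟙-mono (yes p) (no ¬q) P→Q = contradiction (P→Q p) ¬q
𝟙-mono (no _)  _       _   = z≤n

𝟙-cong : ∀ {p q} {P : Set p} {Q : Set q} (P? : Dec P) (Q? : Dec Q) → (P → Q) → (Q → P) → 𝟙 P? ≡ 𝟙 Q?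
𝟙-cong P? Q? P→Q Q→P = ≤-antisym (𝟙-mono P? Q? P→Q) (𝟙-mono Q? P? Q→P)

𝟙+𝟙¬ : ∀ {p} {P : Set p} (P? : Dec P) → 𝟙 P? + 𝟙 (¬? P?) ≡ 1
𝟙+𝟙¬ (yes _) = refl
𝟙+𝟙¬ (no _)  = refl

δ : ∀ {r} → Fin r → Fin r → ℕ
δ x y = 𝟙 (x ≟ y)

δ-refl : ∀ {r} (x : Fin r) → δ x x ≡ 1
δ-refl x = 𝟙-yes (x ≟ x) refl

δ-sym : ∀ {r} (x y : Fin r) → δ x y ≡ δ y x
δ-sym x y = 𝟙-cong (x ≟ y) (y ≟ x) sym sym

δ-suc : ∀ {r} (x y : Fin r) → δ (suc x) (suc y) ≡ δ x y
δ-suc x y = 𝟙-cong (suc x ≟ suc y) (x ≟ y) suc-injective (cong suc)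

∑-δ* : ∀ {r} (x : Fin r) (f : Fin r → ℕ) → ∑[ c < r ] (δ x c * f c) ≡ f x
∑-δ* {suc r} zero f =
  trans (cong₂ _+_ (+-identityʳ (f zero)) (trans (∑-const r 0) (*-zeroʳ r))) (+-identityʳ (f zero))
∑-δ* {suc r} (suc x) f = trans (sum-cong-≗ (λ c → cong (_* f (suc c)) (δ-suc x c))) (∑-δ* x (f ∘ suc))

∑-δʳ : ∀ {r} (x : Fin r) → ∑[ c < r ] δ x c ≡ 1
∑-δʳ x = trans (sum-cong-≗ (λ c → sym (*-identityʳ (δ x c)))) (∑-δ* x (λ _ → 1))

∑-δˡ : ∀ {r} (x : Fin r) → ∑[ c < r ] δ c x ≡ 1
∑-δˡ x = trans (sum-cong-≗ (λ c → δ-sym c x)) (∑-δʳ x)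

count : ∀ {m p} {P : Fin m → Set p} → Decidable P → ℕ
count {m} P? = ∑[ i < m ] 𝟙 (P? i)

count≤ : ∀ {m p} {P : Fin m → Set p} (P? : Decidable P) → count P? ≤ m
count≤ {m} P? = ≤-trans (∑-mono-≤ (𝟙≤1 ∘ P?)) (≤-reflexive (∑1≡n m))

DistinctWitnesses : ∀ {m p} → (Fin m → Set p) → ℕ → Set p
DistinctWitnesses {m} P t = Σ (Fin t → Fin m) λ f → Injective _≡_ _≡_ f × (∀ i → P (f i))

module _ {m p} (P : Fin (suc m) → Set p) where

  distinct-map-suc : ∀ {t} → DistinctWitnesses (P ∘ suc) t → DistinctWitnesses P t
  distinct-map-suc (f , f-inj , Pf) = suc ∘ f , f-inj ∘ suc-injective , Pf

  distinct-cons-zero : ∀ {t} → P zero → DistinctWitnesses (P ∘ suc) t → DistinctWitnesses P (suc t)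
  distinct-cons-zero P0 (f , f-inj , Pf) = g , g-inj , Pg
    where
    g : Fin (suc _) → Fin (suc m)
    g zero    = zero
    g (suc i) = suc (f i)
    g-inj : Injective _≡_ _≡_ g
    g-inj {zero}  {zero}  _ = refl
    g-inj {zero}  {suc _} ()
    g-inj {suc _} {zero}  ()
    g-inj {suc i} {suc j} e = cong suc (f-inj (suc-injective e))
    Pg : ∀ i → P (g i)
    Pg zero    = P0
    Pg (suc i) = Pf i

  distinct-avoiding-zero : ∀ {t} ((f , _ , _) : DistinctWitnesses P t) → (∀ i → zero ≢ f i) →
                           DistinctWitnesses (P ∘ suc) t
  distinct-avoiding-zero (f , f-inj , Pf) 0∉f =
      (λ i → punchOut (0∉f i))
    , (λ {i} {j} e → f-inj (punchOut-injective (0∉f i) (0∉f j) e))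
    , (λ i → subst P (sym (punchIn-punchOut (0∉f i))) (Pf i))

  distinct-remove : ∀ {t} ((f , _ , _) : DistinctWitnesses P (suc t)) (i₀ : Fin (suc t)) →
                    f i₀ ≡ zero → DistinctWitnesses (P ∘ suc) t
  distinct-remove (f , f-inj , Pf) i₀ fi₀≡0 = distinct-avoiding-zero
    (f ∘ punchIn i₀ , (λ {i} {j} e → punchIn-injective i₀ i j (f-inj e)) , Pf ∘ punchIn i₀)
    (λ i 0≡f → punchInᵢ≢i i₀ i (f-inj (trans (sym 0≡f) (sym fi₀≡0))))

≤count⇒distinct : ∀ {m t p} {P : Fin m → Set p} (P? : Decidable P) → t ≤ count P? → DistinctWitnesses P t
≤count⇒distinct {t = zero}  _  _ = (λ ()) , (λ { {()} }) , λ ()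
≤count⇒distinct {suc m} {suc t} {P = P} P? t≤ with P? zero
... | yes P0 = distinct-cons-zero P P0 (≤count⇒distinct (P? ∘ suc) (s≤s⁻¹ t≤))
... | no _   = distinct-map-suc P (≤count⇒distinct (P? ∘ suc) t≤)

distinct⇒≤count : ∀ {m t p} {P : Fin m → Set p} (P? : Decidable P) → DistinctWitnesses P t → t ≤ count P?
distinct⇒≤count {t = zero} _ _ = z≤n
distinct⇒≤count {zero} {suc t} _ (f , _) with f zero
... | ()
distinct⇒≤count {suc m} {suc t} {P = P} P? d@(f , _ , Pf) with any? (λ i → f i ≟ zero)
... | no 0∉f = ≤-trans (distinct⇒≤count (P? ∘ suc) (distinct-avoiding-zero P d (λ i 0≡f → 0∉f (i , sym 0≡f))))
                       (m≤n+m _ (𝟙 (P? zero)))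
... | yes (i₀ , fi₀≡0) = begin
  suc t                              ≤⟨ s≤s (distinct⇒≤count (P? ∘ suc) (distinct-remove P d i₀ fi₀≡0)) ⟩
  suc (count (P? ∘ suc))             ≡⟨ cong (_+ count (P? ∘ suc)) (𝟙-yes (P? zero) (subst P fi₀≡0 (Pf i₀))) ⟨
  𝟙 (P? zero) + count (P? ∘ suc)    ∎
  where open ≤-Reasoning

alternating? : ∀ {r m n} (c : Coloring r m n) (u v : Fin n) → Decidable (Alternating2 c u v)
alternating? c u v w = ¬? (c w u ≟ c w v)

agreement : ∀ {M Q} → (Fin M → Fin Q) → (Fin M → Fin Q) → ℕ
agreement {M} x y = ∑[ i < M ] δ (x i) (y i)

agreement-sym : ∀ {M Q} (x y : Fin M → Fin Q) → agreement x y ≡ agreement y x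
agreement-sym x y = sum-cong-≗ (λ i → δ-sym (x i) (y i))

agreements : ∀ {r m n} → Coloring r m n → Fin n → Fin n → ℕ
agreements c u v = agreement (λ w → c w u) (λ w → c w v)

agreements+alternating : ∀ {r m n} (c : Coloring r m n) (u v : Fin n) →
                         agreements c u v + count (alternating? c u v) ≡ m
agreements+alternating {m = m} c u v = begin
  agreements c u v + count (alternating? c u v)  ≡⟨ ∑-distrib-+ (λ w → δ (c w u) (c w v)) (λ w → 𝟙 (alternating? c u v w)) ⟨
  ∑[ w < m ] (δ (c w u) (c w v) + 𝟙 (alternating? c u v w))
                                                 ≡⟨ sum-cong-≗ (λ w → 𝟙+𝟙¬ (c w u ≟ c w v)) ⟩
  ∑[ w < m ] 1                                   ≡⟨ ∑1≡n m ⟩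
  m                                              ∎
  where open ≡-Reasoning

agreements≤⇒attainable : ∀ {r m n} (c : Coloring r m n) A → (∀ u v → u ≢ v → agreements c u v ≤ A) →
                         Attainable2 r m n (m ∸ A)
agreements≤⇒attainable {m = m} c A agreements≤A = c , λ u v u≢v →
  ≤count⇒distinct (alternating? c u v) (begin
    m ∸ A                                       ≤⟨ ∸-monoʳ-≤ m (agreements≤A u v u≢v) ⟩
    m ∸ agreements c u v                        ≡⟨ cong (_∸ agreements c u v) (agreements+alternating c u v) ⟨
    agreements c u v + count (alternating? c u v) ∸ agreements c u v
                                                ≡⟨ m+n∸m≡n (agreements c u v) _ ⟩
    count (alternating? c u v)                  ∎)
  where open ≤-Reasoning

attainable⇒≤m : ∀ {r m n t} → 2 ≤ n → Attainable2 r m n t → t ≤ m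
attainable⇒≤m {n = suc zero} (s≤s ()) _
attainable⇒≤m {n = suc (suc _)} _ (c , paths) =
  ≤-trans (distinct⇒≤count (alternating? c zero (suc zero)) (paths zero (suc zero) λ ()))
          (count≤ (alternating? c zero (suc zero)))

-- Upper bound

2*[m*n]≤m*m+n*n : ∀ m n → 2 * (m * n) ≤ m * m + n * n
2*[m*n]≤m*m+n*n m n = [ ordered , swapped ]′ (≤-total m n)
  where
  ordered : ∀ {m n} → m ≤ n → 2 * (m * n) ≤ m * m + n * n
  ordered {m} m≤n with d , refl ← m≤n⇒∃[o]m+o≡n m≤n =
    subst (2 * (m * (m + d)) ≤_) (expand m d) (m≤m+n _ (d * d))
    where
    expand : ∀ m d → 2 * (m * (m + d)) + d * d ≡ m * m + (m + d) * (m + d)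
    expand = solve-∀
  swapped : n ≤ m → 2 * (m * n) ≤ m * m + n * n
  swapped n≤m = subst₂ _≤_ (cong (2 *_) (*-comm n m)) (+-comm (n * n) (m * m)) (ordered n≤m)

cauchy-schwarz : ∀ n (k : Fin n → ℕ) →
                 (∑[ i < n ] k i) * (∑[ i < n ] k i) ≤ n * ∑[ i < n ] (k i * k i)
cauchy-schwarz zero    k = z≤n
cauchy-schwarz (suc n) k = begin
  (k₀ + S) * (k₀ + S)                  ≡⟨ square-+ k₀ S ⟩
  k₀ * k₀ + 2 * (k₀ * S) + S * S        ≤⟨ +-mono-≤ (+-monoʳ-≤ (k₀ * k₀) cross) (cauchy-schwarz n (k ∘ suc)) ⟩
  k₀ * k₀ + (n * (k₀ * k₀) + S²) + n * S² ≡⟨ regroup k₀ S² n ⟩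
  suc n * (k₀ * k₀ + S²)                ∎
  where
  open ≤-Reasoning
  k₀ S S² : ℕ
  k₀ = k zero
  S  = ∑[ i < n ] k (suc i)
  S² = ∑[ i < n ] (k (suc i) * k (suc i))
  square-+ : ∀ a b → (a + b) * (a + b) ≡ a * a + 2 * (a * b) + b * b
  square-+ = solve-∀
  regroup : ∀ a s n → a * a + (n * (a * a) + s) + n * s ≡ suc n * (a * a + s)
  regroup = solve-∀
  cross : 2 * (k₀ * S) ≤ n * (k₀ * k₀) + S²
  cross = begin
    2 * (k₀ * S)                                  ≡⟨ cong (2 *_) (*-distribˡ-sum k₀ (k ∘ suc)) ⟩
    2 * ∑[ i < n ] (k₀ * k (suc i))               ≡⟨ *-distribˡ-sum 2 (λ i → k₀ * k (suc i)) ⟩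
    ∑[ i < n ] (2 * (k₀ * k (suc i)))             ≤⟨ ∑-mono-≤ (λ i → 2*[m*n]≤m*m+n*n k₀ (k (suc i))) ⟩
    ∑[ i < n ] (k₀ * k₀ + k (suc i) * k (suc i))  ≡⟨ ∑-distrib-+ (λ _ → k₀ * k₀) (λ i → k (suc i) * k (suc i)) ⟩
    ∑[ i < n ] (k₀ * k₀) + S²                     ≡⟨ cong (_+ S²) (∑-const n (k₀ * k₀)) ⟩
    n * (k₀ * k₀) + S²                            ∎

module _ {r n} (g : Fin n → Fin r) where

  classSize : Fin r → ℕ
  classSize c = ∑[ u < n ] δ (g u) c

  collisions : ℕ
  collisions = ∑[ u < n ] ∑[ v < n ] δ (g u) (g v)

  ∑-classSize : ∑[ c < r ] classSize c ≡ n
  ∑-classSize = begin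
    ∑[ c < r ] ∑[ u < n ] δ (g u) c  ≡⟨ ∑-comm (λ c u → δ (g u) c) ⟩
    ∑[ u < n ] ∑[ c < r ] δ (g u) c  ≡⟨ sum-cong-≗ (∑-δʳ ∘ g) ⟩
    ∑[ u < n ] 1                     ≡⟨ ∑1≡n n ⟩
    n                                ∎
    where open ≡-Reasoning

  collisions≡∑classSize² : collisions ≡ ∑[ c < r ] (classSize c * classSize c)
  collisions≡∑classSize² = begin
    ∑[ u < n ] ∑[ v < n ] δ (g u) (g v)
      ≡⟨ sum-cong-≗ (λ u → sum-cong-≗ (λ v → ∑-δ* (g v) (δ (g u)))) ⟨
    ∑[ u < n ] ∑[ v < n ] ∑[ c < r ] (δ (g v) c * δ (g u) c)
      ≡⟨ sum-cong-≗ (λ u → ∑-comm (λ v c → δ (g v) c * δ (g u) c)) ⟩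
    ∑[ u < n ] ∑[ c < r ] ∑[ v < n ] (δ (g v) c * δ (g u) c)
      ≡⟨ ∑-comm (λ u c → ∑[ v < n ] (δ (g v) c * δ (g u) c)) ⟩
    ∑[ c < r ] ∑[ u < n ] ∑[ v < n ] (δ (g v) c * δ (g u) c)
      ≡⟨ sum-cong-≗ (λ c → sum-cong-≗ (λ u → *-distribʳ-sum (δ (g u) c) (λ v → δ (g v) c))) ⟨
    ∑[ c < r ] ∑[ u < n ] (classSize c * δ (g u) c)
      ≡⟨ sum-cong-≗ (λ c → *-distribˡ-sum (classSize c) (λ u → δ (g u) c)) ⟨
    ∑[ c < r ] (classSize c * classSize c)
      ∎
    where open ≡-Reasoning

  n*n≤r*collisions : n * n ≤ r * collisions
  n*n≤r*collisions = subst₂ _≤_ (cong₂ _*_ ∑-classSize ∑-classSize) (cong (r *_) (sym collisions≡∑classSize²))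
                            (cauchy-schwarz r classSize)

module _ {r m n t} (c : Coloring r m n) (paths : ∀ u v → u ≢ v → DisjointAltPaths2 c u v t) where

  private
    ∑∑ : (Fin n → Fin n → ℕ) → ℕ
    ∑∑ f = ∑[ u < n ] ∑[ v < n ] f u v

    A D : Fin n → Fin n → ℕ
    A = agreements c
    D u v = count (alternating? c u v)

  -- Diagonal pairs carry no paths; the term t * δ u v pays for them.
  t≤D+t*δ : ∀ u v → t ≤ D u v + t * δ u v
  t≤D+t*δ u v with u ≟ v
  ... | yes _   = ≤-trans (≤-reflexive (sym (*-identityʳ t))) (m≤n+m _ _)
  ... | no  u≢v = ≤-trans (distinct⇒≤count (alternating? c u v) (paths u v u≢v)) (m≤m+n _ _)

  n*n*t≤∑∑D+n*t : n * n * t ≤ ∑∑ D + n * t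
  n*n*t≤∑∑D+n*t = begin
    n * n * t                             ≡⟨ trans (*-assoc n n t) (cong (n *_) (sym (∑-const n t))) ⟩
    n * ∑[ v < n ] t                      ≡⟨ ∑-const n _ ⟨
    ∑∑ (λ _ _ → t)                        ≤⟨ ∑-mono-≤ (λ u → ∑-mono-≤ (t≤D+t*δ u)) ⟩
    ∑∑ (λ u v → D u v + t * δ u v)        ≡⟨ sum-cong-≗ (λ u → ∑-distrib-+ (D u) (λ v → t * δ u v)) ⟩
    ∑[ u < n ] (∑[ v < n ] D u v + ∑[ v < n ] (t * δ u v))
                                          ≡⟨ ∑-distrib-+ (λ u → ∑[ v < n ] D u v) (λ u → ∑[ v < n ] (t * δ u v)) ⟩
    ∑∑ D + ∑∑ (λ u v → t * δ u v)         ≡⟨ cong (∑∑ D +_) (trans (sum-cong-≗ diagonal) (∑-const n t)) ⟩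
    ∑∑ D + n * t                          ∎
    where
    open ≤-Reasoning
    diagonal : ∀ u → ∑[ v < n ] (t * δ u v) ≡ t
    diagonal u = trans (sym (*-distribˡ-sum t (δ u))) (trans (cong (t *_) (∑-δʳ u)) (*-identityʳ t))

  m*[n*n]≤r*∑∑A : m * (n * n) ≤ r * ∑∑ A
  m*[n*n]≤r*∑∑A = begin
    m * (n * n)                          ≡⟨ ∑-const m (n * n) ⟨
    ∑[ w < m ] (n * n)                   ≤⟨ ∑-mono-≤ (n*n≤r*collisions ∘ c) ⟩
    ∑[ w < m ] (r * collisions (c w))    ≡⟨ *-distribˡ-sum r (collisions ∘ c) ⟨
    r * ∑[ w < m ] collisions (c w)      ≡⟨ cong (r *_) ∑∑A≡∑collisions ⟨
    r * ∑∑ A                             ∎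
    where
    open ≤-Reasoning
    ∑∑A≡∑collisions : ∑∑ A ≡ ∑[ w < m ] collisions (c w)
    ∑∑A≡∑collisions = trans (sum-cong-≗ (λ u → ∑-comm (λ v w → δ (c w u) (c w v))))
                            (∑-comm (λ u w → ∑[ v < n ] δ (c w u) (c w v)))

  ∑∑A+∑∑D : ∑∑ A + ∑∑ D ≡ m * (n * n)
  ∑∑A+∑∑D = begin
    ∑∑ A + ∑∑ D                      ≡⟨ ∑-distrib-+ (λ u → ∑[ v < n ] A u v) (λ u → ∑[ v < n ] D u v) ⟨
    ∑[ u < n ] (∑[ v < n ] A u v + ∑[ v < n ] D u v)
                                     ≡⟨ sum-cong-≗ (λ u → ∑-distrib-+ (A u) (D u)) ⟨
    ∑∑ (λ u v → A u v + D u v)        ≡⟨ sum-cong-≗ (λ u → sum-cong-≗ (agreements+alternating c u)) ⟩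
    ∑∑ (λ _ _ → m)                    ≡⟨ trans (sum-cong-≗ {n} (λ _ → ∑-const n m)) (∑-const n (n * m)) ⟩
    n * (n * m)                       ≡⟨ trans (sym (*-assoc n n m)) (*-comm (n * n) m) ⟩
    m * (n * n)                       ∎
    where open ≡-Reasoning

  double-counting : r * (n * n * t) + m * (n * n) ≤ r * (m * (n * n)) + r * (n * t)
  double-counting = begin
    r * (n * n * t) + m * (n * n)      ≤⟨ +-mono-≤ (*-monoʳ-≤ r n*n*t≤∑∑D+n*t) m*[n*n]≤r*∑∑A ⟩
    r * (∑∑ D + n * t) + r * ∑∑ A      ≡⟨ regroup r (∑∑ A) (∑∑ D) (n * t) ⟩
    r * (∑∑ A + ∑∑ D) + r * (n * t)    ≡⟨ cong (λ x → r * x + r * (n * t)) ∑∑A+∑∑D ⟩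
    r * (m * (n * n)) + r * (n * t)    ∎
    where
    open ≤-Reasoning
    regroup : ∀ r a d x → r * (d + x) + r * a ≡ r * (a + d) + r * x
    regroup = solve-∀

attainable-upper-bound : ∀ {r m n t} .{{_ : NonZero n}} → Attainable2 r m n t →
                         r * t * n + m * n ≤ r * m * n + r * t
attainable-upper-bound {r} {m} {n} {t} (c , paths) =
  *-cancelˡ-≤ n (subst₂ _≤_ (factorˡ r m n t) (factorʳ r m n t) (double-counting c paths))
  where
  factorˡ : ∀ r m n t → r * (n * n * t) + m * (n * n) ≡ n * (r * t * n + m * n)
  factorˡ = solve-∀
  factorʳ : ∀ r m n t → r * (m * (n * n)) + r * (n * t) ≡ n * (r * m * n + r * t)
  factorʳ = solve-∀

-- Lower bound

module _ (r : ℕ) where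

  ∑-finToFun-δ : ∀ Q (x : Fin (suc Q)) (c : Fin r) →
                 ∑[ k < r ^ suc Q ] δ (finToFun {r} k x) c ≡ r ^ Q
  ∑-finToFun-δ Q zero c = begin
    ∑[ i < r * r ^ Q ] uncurry (λ a _ → δ a c) (remQuot (r ^ Q) i)  ≡⟨ ∑-remQuot r (r ^ Q) (λ a _ → δ a c) ⟩
    ∑[ a < r ] ∑[ k < r ^ Q ] δ a c                                ≡⟨ ∑-comm (λ a (_ : Fin (r ^ Q)) → δ a c) ⟩
    ∑[ k < r ^ Q ] ∑[ a < r ] δ a c                                ≡⟨ sum-cong-≗ {r ^ Q} (λ _ → ∑-δˡ c) ⟩
    ∑[ k < r ^ Q ] 1                                               ≡⟨ ∑1≡n (r ^ Q) ⟩
    r ^ Q                                                          ∎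
    where open ≡-Reasoning
  ∑-finToFun-δ (suc Q) (suc x) c =
    trans (∑-remQuot r (r ^ suc Q) (λ _ k → δ (finToFun {r} k x) c))
          (trans (sum-cong-≗ {r} (λ _ → ∑-finToFun-δ Q x c)) (∑-const r (r ^ Q)))

  ∑-finToFun-δ-≢ : ∀ Q {x y : Fin (suc Q)} → x ≢ y →
                   ∑[ k < r ^ suc Q ] δ (finToFun {r} k x) (finToFun {r} k y) ≡ r ^ Q
  ∑-finToFun-δ-≢ Q {zero} {zero} x≢y = contradiction refl x≢y
  ∑-finToFun-δ-≢ (suc Q) {zero} {suc y} _ =
    trans (∑-remQuot r (r ^ suc Q) (λ a k → δ a (finToFun {r} k y)))
          (trans (sum-cong-≗ {r} (λ a → trans (sum-cong-≗ (λ k → δ-sym a (finToFun {r} k y))) (∑-finToFun-δ Q y a)))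
                 (∑-const r (r ^ Q)))
  ∑-finToFun-δ-≢ (suc Q) {suc x} {zero} _ =
    trans (∑-remQuot r (r ^ suc Q) (λ a k → δ (finToFun {r} k x) a))
          (trans (sum-cong-≗ {r} (λ a → ∑-finToFun-δ Q x a)) (∑-const r (r ^ Q)))
  ∑-finToFun-δ-≢ (suc Q) {suc x} {suc y} sx≢sy =
    trans (∑-remQuot r (r ^ suc Q) (λ _ k → δ (finToFun {r} k x) (finToFun {r} k y)))
          (trans (sum-cong-≗ {r} (λ _ → ∑-finToFun-δ-≢ Q (sx≢sy ∘ cong suc))) (∑-const r (r ^ Q)))

  ∑-finToFun-δ≤ : ∀ Q (x y : Fin (suc Q)) →
                  ∑[ k < r ^ suc Q ] δ (finToFun {r} k x) (finToFun {r} k y) ≤ δ x y * r ^ suc Q + r ^ Q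
  ∑-finToFun-δ≤ Q x y with x ≟ y
  ... | no x≢y = ≤-reflexive (∑-finToFun-δ-≢ Q x≢y)
  ... | yes _  = begin
    ∑[ k < r ^ suc Q ] δ (finToFun {r} k x) (finToFun {r} k y)  ≤⟨ count≤ (λ k → finToFun {r} k x ≟ finToFun {r} k y) ⟩
    r ^ suc Q                                                   ≡⟨ +-identityʳ (r ^ suc Q) ⟨
    1 * r ^ suc Q                                               ≤⟨ m≤m+n _ (r ^ Q) ⟩
    1 * r ^ suc Q + r ^ Q                                       ∎
    where open ≤-Reasoning

threshold-split : ∀ {p} {P : Set p} (P? : Dec P) a A →
                  𝟙 (suc a ≤? 𝟙 P? + A) ≤ 𝟙 (suc a ≤? A) + 𝟙 P? * 𝟙 (a ≤? A)
threshold-split (yes _) a A = ≤-trans (𝟙-mono (suc a ≤? suc A) (a ≤? A) s≤s⁻¹)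
                                      (≤-trans (≤-reflexive (sym (+-identityʳ _))) (m≤n+m _ (𝟙 (suc a ≤? A))))
threshold-split (no _)  a A = ≤-reflexive (sym (+-identityʳ _))

module _ (Q : ℕ) where

  closeWords : ∀ M → ℕ → (Fin M → Fin Q) → ℕ
  closeWords M a w = ∑[ k < Q ^ M ] 𝟙 (a ≤? agreement (finToFun {Q} {M} k) w)

  -- In effect closeWords M a w ≤ (M choose a)·Q^(M−a) ≤ 2^M·Q^(M−a).
  closeWords*Q^a≤ : ∀ M a (w : Fin M → Fin Q) → closeWords M a w * Q ^ a ≤ 2 ^ M * Q ^ M
  closeWords*Q^a≤ zero    zero    w = ≤-refl
  closeWords*Q^a≤ zero    (suc a) w = z≤n
  closeWords*Q^a≤ (suc M) zero    w = begin
    closeWords (suc M) 0 w * 1  ≡⟨ *-identityʳ _ ⟩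
    closeWords (suc M) 0 w      ≤⟨ count≤ (λ k → 0 ≤? agreement (finToFun {Q} k) w) ⟩
    Q ^ suc M                    ≤⟨ m≤n*m (Q ^ suc M) (2 ^ suc M) {{m^n≢0 2 (suc M)}} ⟩
    2 ^ suc M * Q ^ suc M        ∎
    where open ≤-Reasoning
  closeWords*Q^a≤ (suc M) (suc a) w = begin
    closeWords (suc M) (suc a) w * Q ^ suc a
      ≡⟨ cong (_* Q ^ suc a) (∑-remQuot Q (Q ^ M) (λ c k → 𝟙 (suc a ≤? δ c (w zero) + A k))) ⟩
    ∑[ c < Q ] ∑[ k < Q ^ M ] 𝟙 (suc a ≤? δ c (w zero) + A k) * Q ^ suc a
      ≤⟨ *-monoˡ-≤ (Q ^ suc a) (∑-mono-≤ (λ c → ∑-mono-≤ (λ k → threshold-split (c ≟ w zero) a (A k)))) ⟩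
    ∑[ c < Q ] ∑[ k < Q ^ M ] (𝟙 (suc a ≤? A k) + δ c (w zero) * 𝟙 (a ≤? A k)) * Q ^ suc a
      ≡⟨ cong (_* Q ^ suc a) (sum-cong-≗ split) ⟩
    ∑[ c < Q ] (far + δ c (w zero) * near) * Q ^ suc a
      ≡⟨ cong (_* Q ^ suc a) (trans (∑-distrib-+ (λ _ → far) (λ c → δ c (w zero) * near))
                                   (cong₂ _+_ (∑-const Q far) sift)) ⟩
    (Q * far + near) * Q ^ suc a
      ≡⟨ regroup Q far near (Q ^ a) ⟩
    Q * (far * Q ^ suc a) + Q * (near * Q ^ a)
      ≤⟨ +-mono-≤ (*-monoʳ-≤ Q (closeWords*Q^a≤ M (suc a) (w ∘ suc))) (*-monoʳ-≤ Q (closeWords*Q^a≤ M a (w ∘ suc))) ⟩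
    Q * (2 ^ M * Q ^ M) + Q * (2 ^ M * Q ^ M)
      ≡⟨ double Q (2 ^ M) (Q ^ M) ⟩
    2 ^ suc M * Q ^ suc M
      ∎
    where
    open ≤-Reasoning
    A : Fin (Q ^ M) → ℕ
    A k = agreement (finToFun {Q} {M} k) (w ∘ suc)
    far near : ℕ
    far  = closeWords M (suc a) (w ∘ suc)
    near = closeWords M a (w ∘ suc)
    split : ∀ c → ∑[ k < Q ^ M ] (𝟙 (suc a ≤? A k) + δ c (w zero) * 𝟙 (a ≤? A k)) ≡ far + δ c (w zero) * near
    split c = trans (∑-distrib-+ (λ k → 𝟙 (suc a ≤? A k)) (λ k → δ c (w zero) * 𝟙 (a ≤? A k)))
                    (cong (far +_) (sym (*-distribˡ-sum (δ c (w zero)) (λ k → 𝟙 (a ≤? A k)))))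
    sift : ∑[ c < Q ] (δ c (w zero) * near) ≡ near
    sift = trans (sym (*-distribʳ-sum near (λ c → δ c (w zero)))) (trans (cong (_* near) (∑-δˡ (w zero))) (*-identityˡ near))
    regroup : ∀ q f n x → (q * f + n) * (q * x) ≡ q * (f * (q * x)) + q * (n * x)
    regroup = solve-∀
    double : ∀ q t x → q * (t * x) + q * (t * x) ≡ (2 * t) * (q * x)
    double = solve-∀

FarCode : ∀ (Q M a k : ℕ) → Set
FarCode Q M a k = Σ (Fin k → Fin M → Fin Q) λ word → ∀ u v → u ≢ v → agreement (word u) (word v) < a

module _ (Q : ℕ) .{{_ : NonZero Q}} (M a : ℕ) where

  far-word-exists : ∀ {k} (word : Fin k → Fin M → Fin Q) → k * 2 ^ M < Q ^ a →
                    ∃[ w ] ∀ i → agreement w (word i) < a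
  far-word-exists {k} word k2^M<Q^a = finToFun {Q} {M} w , λ i → ≰⇒> (𝟙≡0⇒¬ (a ≤? _) (∑≡0⇒≡0 _ w-isolated i))
    where
    closeCodewords : Fin (Q ^ M) → ℕ
    closeCodewords x = ∑[ i < k ] 𝟙 (a ≤? agreement (finToFun {Q} {M} x) (word i))

    ∑closeCodewords<Q^M : ∑[ x < Q ^ M ] closeCodewords x < Q ^ M
    ∑closeCodewords<Q^M = *-cancelʳ-< (Q ^ a) _ _ (begin-strict
      ∑[ x < Q ^ M ] closeCodewords x * Q ^ a        ≡⟨ cong (_* Q ^ a) (∑-comm (λ x i → 𝟙 (a ≤? agreement (finToFun {Q} {M} x) (word i)))) ⟩
      ∑[ i < k ] closeWords Q M a (word i) * Q ^ a    ≡⟨ *-distribʳ-sum (Q ^ a) (closeWords Q M a ∘ word) ⟩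
      ∑[ i < k ] (closeWords Q M a (word i) * Q ^ a)  ≤⟨ ∑-mono-≤ (closeWords*Q^a≤ Q M a ∘ word) ⟩
      ∑[ i < k ] (2 ^ M * Q ^ M)                      ≡⟨ trans (∑-const k _) (sym (*-assoc k _ _)) ⟩
      k * 2 ^ M * Q ^ M                               <⟨ *-monoˡ-< (Q ^ M) {{m^n≢0 Q M}} k2^M<Q^a ⟩
      Q ^ a * Q ^ M                                   ≡⟨ *-comm (Q ^ a) (Q ^ M) ⟩
      Q ^ M * Q ^ a                                   ∎)
      where open ≤-Reasoning

    w : Fin (Q ^ M)
    w = proj₁ (∑<n⇒∃≡0 closeCodewords ∑closeCodewords<Q^M)
    w-isolated : closeCodewords w ≡ 0
    w-isolated = proj₂ (∑<n⇒∃≡0 closeCodewords ∑closeCodewords<Q^M)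

  greedy-code : ∀ k → k * 2 ^ M < Q ^ a → FarCode Q M a k
  greedy-code zero    _ = (λ ()) , λ ()
  greedy-code (suc k) [k+1]2^M<Q^a = extend , extend-far
    where
    k2^M<Q^a : k * 2 ^ M < Q ^ a
    k2^M<Q^a = ≤-<-trans (*-monoˡ-≤ (2 ^ M) (n≤1+n k)) [k+1]2^M<Q^a
    word : Fin k → Fin M → Fin Q
    word = proj₁ (greedy-code k k2^M<Q^a)
    far : ∀ u v → u ≢ v → agreement (word u) (word v) < a
    far = proj₂ (greedy-code k k2^M<Q^a)
    new : Fin M → Fin Q
    new = proj₁ (far-word-exists word k2^M<Q^a)
    new-far : ∀ i → agreement new (word i) < a
    new-far = proj₂ (far-word-exists word k2^M<Q^a)

    extend : Fin (suc k) → Fin M → Fin Q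
    extend zero    = new
    extend (suc i) = word i

    extend-far : ∀ u v → u ≢ v → agreement (extend u) (extend v) < a
    extend-far zero    zero    0≢0 = contradiction refl 0≢0
    extend-far zero    (suc v) _   = new-far v
    extend-far (suc u) zero    _   = subst (_< a) (agreement-sym new (word u)) (new-far u)
    extend-far (suc u) (suc v) u≢v = far u v (u≢v ∘ cong suc)

module _ {r Q M n a} (word : Fin n → Fin M → Fin (suc Q)) (far : ∀ u v → u ≢ v → agreement (word u) (word v) < a)
         (c₀ : Fin r) (ℓ : ℕ) where

  private
    L : ℕ
    L = r ^ suc Q

    colour : Fin (M * L) ⊎ Fin ℓ → Fin n → Fin r
    colour (inj₁ z) u = uncurry (λ i k → finToFun {r} k (word u i)) (remQuot L z)
    colour (inj₂ _) _ = c₀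

  concatenation : Coloring r (M * L + ℓ) n
  concatenation w = colour (splitAt (M * L) w)

  concatenation-agreements : ∀ u v → u ≢ v → agreements concatenation u v ≤ (a ∸ 1) * L + M * r ^ Q + ℓ
  concatenation-agreements u v u≢v = begin
    agreements concatenation u v
      ≡⟨ ∑-splitAt (M * L) ℓ (λ s → δ (colour s u) (colour s v)) ⟩
    ∑[ z < M * L ] δ (colour (inj₁ z) u) (colour (inj₁ z) v) + ∑[ i < ℓ ] δ c₀ c₀
      ≡⟨ cong₂ _+_ (∑-remQuot M L (λ i k → δ (finToFun {r} k (word u i)) (finToFun {r} k (word v i))))
                   (trans (sum-cong-≗ {ℓ} (λ _ → δ-refl c₀)) (∑1≡n ℓ)) ⟩
    ∑[ i < M ] ∑[ k < L ] δ (finToFun {r} k (word u i)) (finToFun {r} k (word v i)) + ℓ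
      ≤⟨ +-monoˡ-≤ ℓ (∑-mono-≤ (λ i → ∑-finToFun-δ≤ r Q (word u i) (word v i))) ⟩
    ∑[ i < M ] (δ (word u i) (word v i) * L + r ^ Q) + ℓ
      ≡⟨ cong (_+ ℓ) (trans (∑-distrib-+ (λ i → δ (word u i) (word v i) * L) (λ _ → r ^ Q))
                            (cong₂ _+_ (sym (*-distribʳ-sum L (λ i → δ (word u i) (word v i)))) (∑-const M (r ^ Q)))) ⟩
    agreement (word u) (word v) * L + M * r ^ Q + ℓ
      ≤⟨ +-monoˡ-≤ ℓ (+-monoˡ-≤ (M * r ^ Q) (*-monoˡ-≤ L (∸-monoˡ-≤ 1 (far u v u≢v)))) ⟩
    (a ∸ 1) * L + M * r ^ Q + ℓ
      ∎
    where open ≤-Reasoning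

  concatenation-attainable : Attainable2 r (M * L + ℓ) n (M * L + ℓ ∸ ((a ∸ 1) * L + M * r ^ Q + ℓ))
  concatenation-attainable = agreements≤⇒attainable concatenation _ concatenation-agreements

2^m≤2^n⇒m≤n : ∀ {m n} → 2 ^ m ≤ 2 ^ n → m ≤ n
2^m≤2^n⇒m≤n {m} {n} 2^m≤2^n with m ≤? n
... | yes m≤n = m≤n
... | no  m≰n = contradiction 2^m≤2^n (<⇒≱ (^-monoʳ-< 2 (s≤s (s≤s z≤n)) (≰⇒> m≰n)))

-- Blocks of L columns, one per letter of an outer code over an alphabet of size
-- Q + 1 with agreement below a = M / E, where M = m / L is the number of blocks.
-- Agreement then costs about (1/E + 1/r)·m columns: E = r(j+1) keeps the first
-- term within a factor 1/(j+1) of the second, and Q = 2^(3E) lets the greedy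
-- code have n words.
module _ (r₁ j : ℕ) where

  private
    r E Q L : ℕ
    r = suc r₁
    E = r * suc j
    Q = 2 ^ (3 * E)
    L = r ^ suc Q

    instance
      L≢0 : NonZero L
      L≢0 = m^n≢0 r (suc Q)

  exponent : ℕ
  exponent = (2 + 3 * E) * L

  many-blocks : ∀ {m n} → 2 ≤ n → n ^ exponent ≤ 2 ^ m → 2 + 3 * E ≤ m / L
  many-blocks {m} 2≤n n^C≤2^m = begin
    2 + 3 * E               ≡⟨ m*n/n≡m (2 + 3 * E) L ⟨
    exponent / L            ≤⟨ /-monoˡ-≤ L (2^m≤2^n⇒m≤n (≤-trans (^-monoˡ-≤ exponent 2≤n) n^C≤2^m)) ⟩
    m / L                   ∎
    where open ≤-Reasoning

  n≤2^[1+m/L] : ∀ {m n} → n ^ exponent ≤ 2 ^ m → n ≤ 2 ^ suc (m / L)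
  n≤2^[1+m/L] {m} {n} n^C≤2^m with n ≤? 2 ^ suc (m / L)
  ... | yes n≤ = n≤
  ... | no  n≰ = contradiction (begin-strict
    2 ^ (suc M * L)      ≡⟨ ^-*-assoc 2 (suc M) L ⟨
    (2 ^ suc M) ^ L      <⟨ ^-monoˡ-< L (≰⇒> n≰) ⟩
    n ^ L                ≤⟨ ^-monoʳ-≤ n {{>-nonZero (≤-trans (s≤s z≤n) (≰⇒> n≰))}} (m≤n*m L (2 + 3 * E)) ⟩
    n ^ exponent         ≤⟨ n^C≤2^m ⟩
    2 ^ m                <⟨ ^-monoʳ-< 2 (s≤s (s≤s z≤n)) m<[1+M]*L ⟩
    2 ^ (suc M * L)      ∎) (<-irrefl refl)
    where
    open ≤-Reasoning
    M : ℕ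
    M = m / L
    m<[1+M]*L : m < suc M * L
    m<[1+M]*L = begin-strict
      m                  ≡⟨ m≡m%n+[m/n]*n m L ⟩
      m % L + M * L      <⟨ +-monoˡ-< (M * L) (m%n<n m L) ⟩
      L + M * L          ∎

  code-condition : ∀ {M n} → 3 * E ≤ M → n ≤ 2 ^ suc M → n * 2 ^ M < suc Q ^ (M / E)
  code-condition {M} {n} 3E≤M n≤2^[1+M] = begin-strict
    n * 2 ^ M            ≤⟨ *-monoˡ-≤ (2 ^ M) n≤2^[1+M] ⟩
    2 ^ suc M * 2 ^ M    ≡⟨ ^-distribˡ-+-* 2 (suc M) M ⟨
    2 ^ (suc M + M)      <⟨ ^-monoʳ-< 2 (s≤s (s≤s z≤n)) 2M+1<3Ea ⟩
    2 ^ (3 * E * a)      ≡⟨ ^-*-assoc 2 (3 * E) a ⟨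
    Q ^ a                ≤⟨ ^-monoˡ-≤ a (n≤1+n Q) ⟩
    suc Q ^ a            ∎
    where
    open ≤-Reasoning
    a : ℕ
    a = M / E
    1+M≤E+aE : suc M ≤ E + a * E
    1+M≤E+aE = begin
      suc M              ≡⟨ cong suc (m≡m%n+[m/n]*n M E) ⟩
      suc (M % E + a * E) ≤⟨ +-monoˡ-≤ (a * E) (m%n<n M E) ⟩
      E + a * E          ∎
    2M+1<3Ea : suc M + M < 3 * E * a
    2M+1<3Ea = +-cancelˡ-≤ M _ _ (begin
      M + suc (suc M + M) ≤⟨ ≤-trans (n≤1+n _) (≤-reflexive (triple M)) ⟩
      3 * suc M           ≤⟨ *-monoʳ-≤ 3 1+M≤E+aE ⟩
      3 * (E + a * E)     ≡⟨ distribute E a ⟩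
      3 * E + 3 * E * a   ≤⟨ +-monoˡ-≤ (3 * E * a) 3E≤M ⟩
      M + 3 * E * a       ∎)
      where
      triple : ∀ M → suc (M + suc (suc M + M)) ≡ 3 * suc M
      triple = solve-∀
      distribute : ∀ E a → 3 * (E + a * E) ≡ 3 * E + 3 * E * a
      distribute = solve-∀

  agreement-budget : ∀ M ℓ a → 1 ≤ a → a * E ≤ M → ℓ ≤ L →
                     r * ((a ∸ 1) * L + M * r ^ Q + ℓ) * suc j ≤ (M * L + ℓ) + (M * L + ℓ) * suc j
  agreement-budget M ℓ (suc a) _ [1+a]E≤M ℓ≤L = begin
    r * (a * L + M * q + ℓ) * suc j             ≤⟨ *-monoˡ-≤ (suc j) (*-monoʳ-≤ r (+-monoʳ-≤ (a * L + M * q) ℓ≤L)) ⟩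
    r * (a * L + M * q + L) * suc j             ≡⟨ regroup r q M a (suc j) ⟩
    suc a * E * L + M * L * suc j               ≤⟨ +-monoˡ-≤ (M * L * suc j) (*-monoˡ-≤ L [1+a]E≤M) ⟩
    M * L + M * L * suc j                       ≤⟨ +-mono-≤ (m≤m+n (M * L) ℓ) (*-monoˡ-≤ (suc j) (m≤m+n (M * L) ℓ)) ⟩
    (M * L + ℓ) + (M * L + ℓ) * suc j           ∎
    where
    open ≤-Reasoning
    q : ℕ
    q = r ^ Q
    regroup : ∀ r q M a s → r * (a * (r * q) + M * q + r * q) * s ≡ suc a * (r * s) * (r * q) + M * (r * q) * s
    regroup = solve-∀

  lower-bound : ∀ {m n} → 2 ≤ n → n ^ exponent ≤ 2 ^ m →
                ∃[ A ] Attainable2 r m n (m ∸ A) × r * A * suc j ≤ m + m * suc j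
  lower-bound {m} {n} 2≤n n^C≤2^m = A , attainable , budget
    where
    M ℓ a A : ℕ
    M = m / L
    ℓ = m % L
    a = M / E
    A = (a ∸ 1) * L + M * r ^ Q + ℓ
    m≡ : M * L + ℓ ≡ m
    m≡ = trans (+-comm (M * L) ℓ) (sym (m≡m%n+[m/n]*n m L))
    3E≤M : 3 * E ≤ M
    3E≤M = ≤-trans (m≤n+m (3 * E) 2) (many-blocks 2≤n n^C≤2^m)
    code : FarCode (suc Q) M a n
    code = greedy-code (suc Q) M a n (code-condition 3E≤M (n≤2^[1+m/L] n^C≤2^m))
    attainable : Attainable2 r m n (m ∸ A)
    attainable = subst (λ x → Attainable2 r x n (x ∸ A)) m≡ (concatenation-attainable {r = r} (proj₁ code) (proj₂ code) zero ℓ)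
    1≤a : 1 ≤ a
    1≤a = ≤-trans (≤-reflexive (sym (n/n≡1 E))) (/-monoˡ-≤ E (≤-trans (m≤n*m E 3) 3E≤M))
    budget : r * A * suc j ≤ m + m * suc j
    budget = subst (λ x → r * A * suc j ≤ x + x * suc j) m≡
                   (agreement-budget M ℓ a 1≤a (m/n*n≤m M E) (<⇒≤ (m%n<n m L)))

-- Asymptotics

∣m-n∣*k≤o : ∀ {m n} k o → (m ∸ n) * k ≤ o → (n ∸ m) * k ≤ o → ∣ m - n ∣ * k ≤ o
∣m-n∣*k≤o {m} {n} k o m∸n≤ n∸m≤ with ≤-total m n
... | inj₁ m≤n = subst (λ d → d * k ≤ o) (sym (m≤n⇒∣m-n∣≡n∸m m≤n)) n∸m≤
... | inj₂ n≤m = subst (λ d → d * k ≤ o) (sym (m≤n⇒∣n-m∣≡n∸m n≤m)) m∸n≤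

upper-asymptotic : ∀ r₁ m n t j → 1 ≤ r₁ → t ≤ m → 2 * suc j ≤ n →
                   suc r₁ * t * n + m * n ≤ suc r₁ * m * n + suc r₁ * t →
                   (suc r₁ * t ∸ r₁ * m) * suc j ≤ r₁ * m
upper-asymptotic r₁ m n t j 1≤r₁ t≤m 2[1+j]≤n double-count = *-cancelˡ-≤ 2 (begin
  2 * ((X ∸ Y) * suc j)   ≡⟨ *-comm-2 (X ∸ Y) (suc j) ⟩
  (X ∸ Y) * (2 * suc j)   ≤⟨ *-monoʳ-≤ (X ∸ Y) 2[1+j]≤n ⟩
  (X ∸ Y) * n             ≡⟨ *-distribʳ-∸ n X Y ⟩
  X * n ∸ Y * n           ≤⟨ m≤n+o⇒m∸n≤o (X * n) (Y * n) Xn≤Yn+X ⟩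
  X                       ≤⟨ *-monoʳ-≤ (suc r₁) t≤m ⟩
  suc r₁ * m              ≤⟨ *-monoˡ-≤ m (subst (_≤ r₁ + r₁) (+-comm r₁ 1) (+-monoʳ-≤ r₁ 1≤r₁)) ⟩
  (r₁ + r₁) * m           ≡⟨ cong (_* m) (cong (r₁ +_) (sym (+-identityʳ r₁))) ⟩
  2 * r₁ * m              ≡⟨ *-assoc 2 r₁ m ⟩
  2 * Y                   ∎)
  where
  open ≤-Reasoning
  X Y : ℕ
  X = suc r₁ * t
  Y = r₁ * m
  rearrange : ∀ r₁ m n t → suc r₁ * m * n + suc r₁ * t ≡ r₁ * m * n + suc r₁ * t + m * n
  rearrange = solve-∀
  *-comm-2 : ∀ x y → 2 * (x * y) ≡ x * (2 * y)
  *-comm-2 = solve-∀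
  Xn≤Yn+X : X * n ≤ Y * n + X
  Xn≤Yn+X = +-cancelʳ-≤ (m * n) _ _ (subst (X * n + m * n ≤_) (rearrange r₁ m n t) double-count)

lower-asymptotic : ∀ r₁ m t A j → 1 ≤ r₁ → m ∸ A ≤ t → suc r₁ * A * suc j ≤ m + m * suc j →
                   (r₁ * m ∸ suc r₁ * t) * suc j ≤ r₁ * m
lower-asymptotic r₁ m t A j 1≤r₁ m∸A≤t rA[1+j]≤ with ≤-total (r₁ * m) (suc r₁ * t)
... | inj₁ r₁m≤rt = ≤-trans (≤-reflexive (cong (_* suc j) (m≤n⇒m∸n≡0 r₁m≤rt))) z≤n
... | inj₂ rt≤r₁m = ≤-trans X[1+j]≤m (m≤n*m m r₁ {{>-nonZero 1≤r₁}})
  where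
  X : ℕ
  X = r₁ * m ∸ suc r₁ * t
  X+m≤rA : X + m ≤ suc r₁ * A
  X+m≤rA = +-cancelʳ-≤ (suc r₁ * t) _ _ (begin
    X + m + suc r₁ * t      ≡⟨ trans (+-assoc X m _) (trans (cong (X +_) (+-comm m _)) (sym (+-assoc X _ m))) ⟩
    X + suc r₁ * t + m      ≡⟨ cong (_+ m) (m∸n+n≡m rt≤r₁m) ⟩
    r₁ * m + m              ≡⟨ +-comm (r₁ * m) m ⟩
    suc r₁ * m              ≤⟨ *-monoʳ-≤ (suc r₁) (≤-trans (m≤n+m∸n m A) (+-monoʳ-≤ A m∸A≤t)) ⟩
    suc r₁ * (A + t)        ≡⟨ *-distribˡ-+ (suc r₁) A t ⟩
    suc r₁ * A + suc r₁ * t ∎)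
    where open ≤-Reasoning
  X[1+j]≤m : X * suc j ≤ m
  X[1+j]≤m = +-cancelʳ-≤ (m * suc j) _ _ (begin
    X * suc j + m * suc j   ≡⟨ *-distribʳ-+ (suc j) X m ⟨
    (X + m) * suc j         ≤⟨ *-monoˡ-≤ (suc j) X+m≤rA ⟩
    suc r₁ * A * suc j      ≤⟨ rA[1+j]≤ ⟩
    m + m * suc j           ∎)
    where open ≤-Reasoning

kappa-estimate : ∀ r₁ j {m n k} → 1 ≤ r₁ → 2 * suc j ≤ n → n ^ exponent r₁ j ≤ 2 ^ m →
                 (2 ≤ n → IsKappa2 (suc r₁) m n k) → ∣ suc r₁ * k - r₁ * m ∣ * suc j ≤ r₁ * m
kappa-estimate r₁ j {m} {n} {k} 1≤r₁ 2[1+j]≤n n^C≤2^m isκ =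
  ∣m-n∣*k≤o {suc r₁ * k} (suc j) (r₁ * m) upper lower
  where
  2≤n : 2 ≤ n
  2≤n = ≤-trans (*-monoʳ-≤ 2 (s≤s z≤n)) 2[1+j]≤n
  attainable : Attainable2 (suc r₁) m n k
  attainable = proj₁ (isκ 2≤n)
  maximal : ∀ t → Attainable2 (suc r₁) m n t → t ≤ k
  maximal = proj₂ (isκ 2≤n)
  instance
    n≢0 : NonZero n
    n≢0 = >-nonZero (≤-trans (s≤s z≤n) 2≤n)
  upper : (suc r₁ * k ∸ r₁ * m) * suc j ≤ r₁ * m
  upper = upper-asymptotic r₁ m n k j 1≤r₁ (attainable⇒≤m 2≤n attainable) 2[1+j]≤n
                           (attainable-upper-bound attainable)
  lower : (r₁ * m ∸ suc r₁ * k) * suc j ≤ r₁ * m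
  lower = lower-asymptotic r₁ m k (proj₁ witness) j 1≤r₁ (maximal _ (proj₁ (proj₂ witness))) (proj₂ (proj₂ witness))
    where
    witness : ∃[ A ] Attainable2 (suc r₁) m n (m ∸ A) × suc r₁ * A * suc j ≤ m + m * suc j
    witness = lower-bound r₁ j 2≤n n^C≤2^m

theorem2p1 : (r : ℕ) → 2 ≤ r → (m : ℕ → ℕ) → (∀ n → m n ≤ n) →
    DivergesOverLog m → (κ : ℕ → ℕ) → (∀ n → 2 ≤ n → IsKappa2 r (m n) n (κ n)) →
    AsympKappa r m κ
theorem2p1 (suc r₁) (s≤s 1≤r₁) m _ diverges κ isκ j with N , n^C≤2^m ← diverges (exponent r₁ j) =
  N + 2 * suc j , λ n N+2[1+j]≤n →
    kappa-estimate r₁ j 1≤r₁ (m+n≤o⇒n≤o N N+2[1+j]≤n) (n^C≤2^m n (m+n≤o⇒m≤o N N+2[1+j]≤n)) (isκ n)
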